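{- Let $N\ge1$ be an integer and $\chi$ a Dirichlet character of conductor $f$. For $n\ge 1$, \[ B_{N,n,\chi}=\sum_{k=0}^n\frac{k!}{f^{N-k}}\binom{n}{k}\sum_{r=0}^k T_r(k)\, S_{n-k}, \qquad B_{N,n,\chi}(x)=\sum_{k=0}^n\frac{k!}{f^{N-k}}\binom{n}{k}\sum_{r=0}^k T_r(k)\, S_{n-k}(x), \] where \[ T_r(k):=(-N!)^r\sum_{\substack{i_1+\cdots+i_r=k\\ i_1,\dots,i_r\ge 1}}\frac{1}{(N+i_1)!\cdots(N+i_r)!} \] with $T_0(0)=1$ and $T_0(k)=0$ for $k\ge 1$.
   Context: For an integer $N\ge 1$ and a Dirichlet character $\chi$ of conductor $f$, the generalized hypergeometric Bernoulli numbers $B_{N,n,\chi}$ and polynomials $B_{N,n,\chi}(x)$ are defined by $\sum_{a=1}^f \frac{\chi(a)\, t^N e^{at}/N!}{e^{ft}-\sum_{m=0}^{N-1}\frac{(ft)^m}{m!}}=\sum_{n=0}^\infty B_{N,n,\chi}\frac{t^n}{n!}$ and $\sum_{a=1}^f \frac{\chi(a)\, t^N e^{(x+a)t}/N!}{e^{ft}-\sum_{m=0}^{N-1}\frac{(ft)^m}{m!}}=\sum_{n=0}^\infty B_{N,n,\chi}(x)\frac{t^n}{n!}$ for $|t|<2\pi/f$. Put $S_n:=\sum_{a=1}^f\chi(a)a^n$ and $S_n(x):=\sum_{a=1}^f\chi(a)(x+a)^n$. -}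

module Defs where

open import Level using (Level; _⊔_)
open import Algebra.Bundles using (CommutativeRing)
open import Data.Nat as ℕ using (ℕ; zero; suc; _≤_; _<_; _≤?_; _∸_)
open import Data.Nat.Divisibility using () renaming (_∣_ to _∣ℕ_)
open import Data.Nat.GCD using (gcd)
open import Data.Nat.Combinatorics using (_C_)
open import Data.Integer as ℤ using (ℤ; +_; ∣_∣)
import Data.Integer.Divisibility as ℤDiv
open import Data.Product using (Σ; _×_; ∃-syntax)
open import Relation.Nullary using (¬_; yes; no)
open import Relation.Binary.PropositionalEquality using (_≡_; _≢_)

fact : ℕ → ℕ
fact zero = 1
fact (suc n) = suc n ℕ.* fact n

module _ {c ℓ : Level} (R : CommutativeRing c ℓ) where
  open CommutativeRing R

  ι : ℕ → Carrier
  ι zero = 0#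
  ι (suc n) = 1# + ι n

  pow : Carrier → ℕ → Carrier
  pow x zero = 1#
  pow x (suc n) = x * pow x n

  sumTo : ℕ → (ℕ → Carrier) → Carrier
  sumTo zero g = g 0
  sumTo (suc n) g = sumTo n g + g (suc n)

  sum1To : ℕ → (ℕ → Carrier) → Carrier
  sum1To zero g = 0#
  sum1To (suc n) g = sum1To n g + g (suc n)

  record IsCharZeroField (inv : Carrier → Carrier) : Set (c ⊔ ℓ) where
    field
      1≉0       : ¬ (1# ≈ 0#)
      inverseʳ  : ∀ x → ¬ (x ≈ 0#) → x * inv x ≈ 1#
      charZero  : ∀ n → ¬ (ι (suc n) ≈ 0#)

  record IsDirichletCharacter (f : ℕ) (χ : ℤ → Carrier) : Set (c ⊔ ℓ) where
    field
      modulus-pos   : 1 ≤ f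
      periodic      : ∀ a → χ (a ℤ.+ + f) ≈ χ a
      multiplicative : ∀ a b → χ (a ℤ.* b) ≈ χ a * χ b
      χ-one         : χ (+ 1) ≈ 1#
      coprime⇒≉0    : ∀ a → gcd ∣ a ∣ f ≡ 1 → ¬ (χ a ≈ 0#)
      noncoprime⇒≈0 : ∀ a → gcd ∣ a ∣ f ≢ 1 → χ a ≈ 0#

  -- Dirichlet character of conductor f: a Dirichlet character modulo f
  -- which is primitive, i.e. for no proper divisor d of f is χ(a) = 1 for
  -- all a coprime to f with a ≡ 1 (mod d).
  record IsDirichletCharacterOfConductor (f : ℕ) (χ : ℤ → Carrier) : Set (c ⊔ ℓ) where
    field
      isDirichletCharacter : IsDirichletCharacter f χ
      isPrimitive : ∀ d → d ∣ℕ f → d < f →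
                  ∃[ a ] (gcd ∣ a ∣ f ≡ 1 × (+ d) ℤDiv.∣ (a ℤ.- + 1) × ¬ (χ a ≈ 1#))

  module _ (inv : Carrier → Carrier) (N f : ℕ) (χ : ℤ → Carrier) where

    S : ℕ → Carrier
    S n = sum1To f (λ a → χ (+ a) * pow (ι a) n)

    Sx : Carrier → ℕ → Carrier
    Sx x n = sum1To f (λ a → χ (+ a) * pow (x + ι a) n)

    -- coefficient of t^j in (e^{ft} - Σ_{m<N} (ft)^m/m!) / t^N,
    -- namely f^{N+j}/(N+j)!
    D : ℕ → Carrier
    D j = pow (ι f) (N ℕ.+ j) * inv (ι (fact (N ℕ.+ j)))

    -- (B n)_n are the generalized hypergeometric Bernoulli numbers B_{N,n,χ}:
    -- the exponential generating function Σ B n t^n/n! equals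
    -- Σ_a χ(a) t^N e^{at}/N! / (e^{ft} - Σ_{m<N}(ft)^m/m!).  As formal
    -- power series, after cancelling t^N, this says
    --   (Σ_j D j t^j) · (Σ_n B n t^n/n!) = Σ_n (S_n/N!) t^n/n!.
    IsHypBernoulliNumbers : (ℕ → Carrier) → Set ℓ
    IsHypBernoulliNumbers B =
      ∀ n → sumTo n (λ j → D j * (B (n ∸ j) * inv (ι (fact (n ∸ j)))))
            ≈ S n * inv (ι (fact N)) * inv (ι (fact n))

    IsHypBernoulliPolys : Carrier → (ℕ → Carrier) → Set ℓ
    IsHypBernoulliPolys x B =
      ∀ n → sumTo n (λ j → D j * (B (n ∸ j) * inv (ι (fact (n ∸ j)))))
            ≈ Sx x n * inv (ι (fact N)) * inv (ι (fact n))

    -- Σ_{i_1+...+i_r = k, i_j ≥ 1} 1/((N+i_1)! ⋯ (N+i_r)!),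
    -- computed by splitting off the first part i_1 = i
    compSum : ℕ → ℕ → Carrier
    compSum zero zero = 1#
    compSum zero (suc k) = 0#
    compSum (suc r) k = sum1To k (λ i → inv (ι (fact (N ℕ.+ i))) * compSum r (k ∸ i))

    T : ℕ → ℕ → Carrier
    T r k = pow (- ι (fact N)) r * compSum r k

    -- 1 / f^{N-k}  (integer exponent N - k)
    invFPow : ℕ → Carrier
    invFPow k with k ≤? N
    ... | yes _ = inv (pow (ι f) (N ∸ k))
    ... | no  _ = pow (ι f) (k ∸ N)

    formula : (ℕ → Carrier) → ℕ → Carrier
    formula s n = sumTo n (λ k →
      ι (fact k) * invFPow k * ι (n C k) * (sumTo k (λ r → T r k) * s (n ∸ k)))

module Submission where

open import Level using (Level)
open import Algebra.Bundles using (CommutativeRing)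
open import Data.Nat as ℕ using (ℕ; zero; suc; _≤_; _<_; _∸_; _≤?_; _!; z≤n; NonZero)
import Data.Nat.Properties as ℕₚ
open import Data.Nat.Combinatorics using (_C_; k![n∸k]!∣n!)
open import Data.Nat.Combinatorics.Specification using (nCk≡n!/k![n-k]!)
open import Data.Nat.DivMod using (m/n*n≡m)
open import Data.Integer using (ℤ)
open import Data.Product using (_×_; _,_)
open import Data.Sum using (inj₁; inj₂)
open import Relation.Nullary using (¬_; yes; no)
open import Relation.Binary.PropositionalEquality as ≡ using (_≡_)
open import Defs

-- Multiplying the defining relation by N!/f^N turns the denominator series into
-- g(t) = Σ_i N! f^i t^i/(N+i)!, which has constant term 1.  Its inverse is the
-- geometric series Σ_r (1 - g(t))^r, and the coefficient of t^k in (1 - g(t))^r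
-- is f^k T_r(k), a sum over the compositions of k into r positive parts.  Hence
-- the Cauchy product of the sequence k ↦ Σ_r T_r(k)/f^{N-k} with the data
-- S_n/n! is B_{N,n,χ}/n!, which is the formula after multiplying by n!.

fact≡! : ∀ n → fact n ≡ n !
fact≡! zero    = ≡.refl
fact≡! (suc n) = ≡.cong (suc n ℕ.*_) (fact≡! n)

fact-nonZero : ∀ n → NonZero (fact n)
fact-nonZero n = ≡.subst NonZero (≡.sym (fact≡! n)) (n ℕₚ.!≢0)

fact*C*fact≡fact : ∀ {n k} → k ≤ n → fact k ℕ.* (n C k) ℕ.* fact (n ∸ k) ≡ fact n
fact*C*fact≡fact {n} {k} k≤n
  rewrite fact≡! k | fact≡! n | fact≡! (n ∸ k) = begin
    k ! ℕ.* (n C k) ℕ.* (n ∸ k) !    ≡⟨ ≡.cong (ℕ._* (n ∸ k) !) (ℕₚ.*-comm (k !) (n C k)) ⟩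
    (n C k) ℕ.* k ! ℕ.* (n ∸ k) !    ≡⟨ ℕₚ.*-assoc (n C k) (k !) ((n ∸ k) !) ⟩
    (n C k) ℕ.* (k ! ℕ.* (n ∸ k) !)  ≡⟨ ≡.cong (ℕ._* (k ! ℕ.* (n ∸ k) !)) (nCk≡n!/k![n-k]! k≤n) ⟩
    _                                ≡⟨ m/n*n≡m {{k ℕₚ.!* (n ∸ k) !≢0}} (k![n∸k]!∣n! k≤n) ⟩
    n !                              ∎
  where open ≡.≡-Reasoning

module Sums {c ℓ : Level} (R : CommutativeRing c ℓ) where
  open CommutativeRing R
  open import Relation.Binary.Reasoning.Setoid setoid

  ∑ : ℕ → (ℕ → Carrier) → Carrier
  ∑ = sumTo R

  ∑₁ : ℕ → (ℕ → Carrier) → Carrier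
  ∑₁ = sum1To R

  ∑-cong : ∀ n {g h : ℕ → Carrier} → (∀ k → k ≤ n → g k ≈ h k) → ∑ n g ≈ ∑ n h
  ∑-cong zero    g≈h = g≈h 0 z≤n
  ∑-cong (suc n) g≈h =
    +-cong (∑-cong n (λ k k≤n → g≈h k (ℕₚ.m≤n⇒m≤1+n k≤n))) (g≈h (suc n) ℕₚ.≤-refl)

  ∑₁-cong : ∀ n {g h : ℕ → Carrier} → (∀ k → 1 ≤ k → k ≤ n → g k ≈ h k) → ∑₁ n g ≈ ∑₁ n h
  ∑₁-cong zero    g≈h = refl
  ∑₁-cong (suc n) g≈h =
    +-cong (∑₁-cong n (λ k 1≤k k≤n → g≈h k 1≤k (ℕₚ.m≤n⇒m≤1+n k≤n))) (g≈h (suc n) (ℕ.s≤s z≤n) ℕₚ.≤-refl)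

  ∑-zero : ∀ n {g : ℕ → Carrier} → (∀ k → k ≤ n → g k ≈ 0#) → ∑ n g ≈ 0#
  ∑-zero zero    g≈0 = g≈0 0 z≤n
  ∑-zero (suc n) g≈0 =
    trans (+-cong (∑-zero n (λ k k≤n → g≈0 k (ℕₚ.m≤n⇒m≤1+n k≤n))) (g≈0 (suc n) ℕₚ.≤-refl))
          (+-identityʳ 0#)

  ∑₁-zero : ∀ n {g : ℕ → Carrier} → (∀ k → 1 ≤ k → k ≤ n → g k ≈ 0#) → ∑₁ n g ≈ 0#
  ∑₁-zero zero    g≈0 = refl
  ∑₁-zero (suc n) g≈0 =
    trans (+-cong (∑₁-zero n (λ k 1≤k k≤n → g≈0 k 1≤k (ℕₚ.m≤n⇒m≤1+n k≤n))) (g≈0 (suc n) (ℕ.s≤s z≤n) ℕₚ.≤-refl))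
          (+-identityʳ 0#)

  ∑-distrib-+ : ∀ n (g h : ℕ → Carrier) → ∑ n (λ k → g k + h k) ≈ ∑ n g + ∑ n h
  ∑-distrib-+ zero    g h = refl
  ∑-distrib-+ (suc n) g h = trans (+-congʳ (∑-distrib-+ n g h)) (interchange _ _ _ _)
    where open import Algebra.Properties.CommutativeSemigroup +-commutativeSemigroup using (interchange)

  ∑-distribˡ : ∀ n x (g : ℕ → Carrier) → x * ∑ n g ≈ ∑ n (λ k → x * g k)
  ∑-distribˡ zero    x g = refl
  ∑-distribˡ (suc n) x g = trans (distribˡ _ _ _) (+-congʳ (∑-distribˡ n x g))

  ∑₁-distribˡ : ∀ n x (g : ℕ → Carrier) → x * ∑₁ n g ≈ ∑₁ n (λ k → x * g k)
  ∑₁-distribˡ zero    x g = zeroʳ x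
  ∑₁-distribˡ (suc n) x g = trans (distribˡ _ _ _) (+-congʳ (∑₁-distribˡ n x g))

  ∑-distribʳ : ∀ n x (g : ℕ → Carrier) → ∑ n g * x ≈ ∑ n (λ k → g k * x)
  ∑-distribʳ n x g =
    trans (*-comm _ _) (trans (∑-distribˡ n x g) (∑-cong n (λ k _ → *-comm x (g k))))

  ∑₁-neg : ∀ n (g : ℕ → Carrier) → ∑₁ n (λ k → - g k) ≈ - ∑₁ n g
  ∑₁-neg n g = begin
    ∑₁ n (λ k → - g k)      ≈⟨ ∑₁-cong n (λ k _ _ → -1*x≈-x (g k)) ⟨
    ∑₁ n (λ k → - 1# * g k) ≈⟨ ∑₁-distribˡ n (- 1#) g ⟨
    - 1# * ∑₁ n g           ≈⟨ -1*x≈-x _ ⟩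
    - ∑₁ n g                ∎
    where open import Algebra.Properties.Ring ring using (-1*x≈-x)

  ∑-unfoldˡ : ∀ n (g : ℕ → Carrier) → ∑ (suc n) g ≈ g 0 + ∑ n (λ k → g (suc k))
  ∑-unfoldˡ zero    g = refl
  ∑-unfoldˡ (suc n) g = trans (+-congʳ (∑-unfoldˡ n g)) (+-assoc _ _ _)

  ∑-split₁ : ∀ n (g : ℕ → Carrier) → ∑ n g ≈ g 0 + ∑₁ n g
  ∑-split₁ zero    g = sym (+-identityʳ _)
  ∑-split₁ (suc n) g = trans (+-congʳ (∑-split₁ n g)) (+-assoc _ _ _)

  ∑-∑₁-comm : ∀ n m (G : ℕ → ℕ → Carrier) →
              ∑ n (λ r → ∑₁ m (λ i → G r i)) ≈ ∑₁ m (λ i → ∑ n (λ r → G r i))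
  ∑-∑₁-comm n zero    G = ∑-zero n (λ _ _ → refl)
  ∑-∑₁-comm n (suc m) G = trans (∑-distrib-+ n _ _) (+-congʳ (∑-∑₁-comm n m G))

  ∑-reverse : ∀ n (g : ℕ → Carrier) → ∑ n g ≈ ∑ n (λ j → g (n ∸ j))
  ∑-reverse zero    g = refl
  ∑-reverse (suc n) g = begin
    ∑ n g + g (suc n)                 ≈⟨ +-congʳ (∑-reverse n g) ⟩
    ∑ n (λ j → g (n ∸ j)) + g (suc n) ≈⟨ +-comm _ _ ⟩
    g (suc n) + ∑ n (λ j → g (n ∸ j)) ≈⟨ ∑-unfoldˡ n (λ j → g (suc n ∸ j)) ⟨
    ∑ (suc n) (λ j → g (suc n ∸ j))   ∎

  ∑-truncate : ∀ m n (g : ℕ → Carrier) → m ≤ n → (∀ k → m < k → k ≤ n → g k ≈ 0#) →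
               ∑ n g ≈ ∑ m g
  ∑-truncate m zero    g z≤n g≈0 = refl
  ∑-truncate m (suc n) g m≤n g≈0 with ℕₚ.m≤n⇒m<n∨m≡n m≤n
  ... | inj₁ m<1+n = trans (+-cong (∑-truncate m n g (ℕₚ.≤-pred m<1+n)
                                      (λ k m<k k≤n → g≈0 k m<k (ℕₚ.m≤n⇒m≤1+n k≤n)))
                                    (g≈0 (suc n) m<1+n ℕₚ.≤-refl))
                           (+-identityʳ _)
  ... | inj₂ ≡.refl = refl

  ∑-triangle : ∀ n (G : ℕ → ℕ → Carrier) →
               ∑ n (λ m → ∑ m (λ i → G i m)) ≈ ∑ n (λ i → ∑ (n ∸ i) (λ j → G i (i ℕ.+ j)))
  ∑-triangle zero    G = refl
  ∑-triangle (suc n) G = begin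
    ∑ n (λ m → ∑ m (λ i → G i m)) + (∑ n (λ i → G i (suc n)) + G (suc n) (suc n))
      ≈⟨ +-congʳ (∑-triangle n G) ⟩
    ∑ n (λ i → ∑ (n ∸ i) (λ j → G i (i ℕ.+ j))) + (∑ n (λ i → G i (suc n)) + G (suc n) (suc n))
      ≈⟨ +-assoc _ _ _ ⟨
    (∑ n (λ i → ∑ (n ∸ i) (λ j → G i (i ℕ.+ j))) + ∑ n (λ i → G i (suc n))) + G (suc n) (suc n)
      ≈⟨ +-congʳ (∑-distrib-+ n _ _) ⟨
    ∑ n (λ i → ∑ (n ∸ i) (λ j → G i (i ℕ.+ j)) + G i (suc n)) + G (suc n) (suc n)
      ≈⟨ +-cong (∑-cong n extend-row) last-row ⟩
    ∑ (suc n) (λ i → ∑ (suc n ∸ i) (λ j → G i (i ℕ.+ j))) ∎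
    where
    extend-row : ∀ i → i ≤ n →
      ∑ (n ∸ i) (λ j → G i (i ℕ.+ j)) + G i (suc n) ≈ ∑ (suc n ∸ i) (λ j → G i (i ℕ.+ j))
    extend-row i i≤n rewrite ℕₚ.+-∸-assoc 1 i≤n =
      +-congˡ (reflexive (≡.cong (G i) (≡.sym (≡.trans (ℕₚ.+-suc i (n ∸ i))
                                                  (≡.cong suc (ℕₚ.m+[n∸m]≡n i≤n))))))
    last-row : G (suc n) (suc n) ≈ ∑ (suc n ∸ suc n) (λ j → G (suc n) (suc n ℕ.+ j))
    last-row rewrite ℕₚ.n∸n≡0 n | ℕₚ.+-identityʳ n = refl

module Powers {c ℓ : Level} (R : CommutativeRing c ℓ) where
  open CommutativeRing R
  open import Algebra.Properties.Semiring.Mult semiring using (×1-homo-*) renaming (_×_ to _×′_)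
  open import Algebra.Properties.Semiring.Exp semiring using (_^_; ^-homo-*)

  ι≡×1 : ∀ n → ι R n ≡ n ×′ 1#
  ι≡×1 zero    = ≡.refl
  ι≡×1 (suc n) = ≡.cong (1# +_) (ι≡×1 n)

  pow≡^ : ∀ x n → pow R x n ≡ x ^ n
  pow≡^ x zero    = ≡.refl
  pow≡^ x (suc n) = ≡.cong (x *_) (pow≡^ x n)

  ι-homo-* : ∀ m n → ι R (m ℕ.* n) ≈ ι R m * ι R n
  ι-homo-* m n rewrite ι≡×1 (m ℕ.* n) | ι≡×1 m | ι≡×1 n = ×1-homo-* m n

  pow-homo-* : ∀ x m n → pow R x (m ℕ.+ n) ≈ pow R x m * pow R x n
  pow-homo-* x m n rewrite pow≡^ x (m ℕ.+ n) | pow≡^ x m | pow≡^ x n = ^-homo-* x m n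

  pow-split : ∀ x {i k} → i ≤ k → pow R x k ≈ pow R x i * pow R x (k ∸ i)
  pow-split x {i} {k} i≤k =
    trans (reflexive (≡.cong (pow R x) (≡.sym (ℕₚ.m+[n∸m]≡n i≤k)))) (pow-homo-* x i (k ∸ i))

module Convolution {c ℓ : Level} (R : CommutativeRing c ℓ) where
  open CommutativeRing R
  open Sums R
  open import Relation.Binary.Reasoning.Setoid setoid

  infixl 7 _⋆_
  _⋆_ : (ℕ → Carrier) → (ℕ → Carrier) → ℕ → Carrier
  (a ⋆ b) n = ∑ n (λ j → a j * b (n ∸ j))

  δ : ℕ → Carrier
  δ zero    = 1#
  δ (suc _) = 0#

  ⋆-congˡ : ∀ {a a′} b → (∀ m → a m ≈ a′ m) → ∀ n → (a ⋆ b) n ≈ (a′ ⋆ b) n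
  ⋆-congˡ b a≈a′ n = ∑-cong n (λ j _ → *-congʳ (a≈a′ j))

  ⋆-congʳ : ∀ a {b b′} → (∀ m → b m ≈ b′ m) → ∀ n → (a ⋆ b) n ≈ (a ⋆ b′) n
  ⋆-congʳ a b≈b′ n = ∑-cong n (λ j _ → *-congˡ (b≈b′ (n ∸ j)))

  ⋆-scaleˡ : ∀ x a b n → ((λ m → x * a m) ⋆ b) n ≈ x * (a ⋆ b) n
  ⋆-scaleˡ x a b n = trans (∑-cong n (λ j _ → *-assoc x (a j) _)) (sym (∑-distribˡ n x _))

  ⋆-comm : ∀ a b n → (a ⋆ b) n ≈ (b ⋆ a) n
  ⋆-comm a b n = trans (∑-reverse n _) (∑-cong n (λ j j≤n →
    trans (*-comm _ _) (*-congʳ (reflexive (≡.cong b (ℕₚ.m∸[m∸n]≡n j≤n))))))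

  ⋆-scaleʳ : ∀ x a b n → (a ⋆ (λ m → x * b m)) n ≈ x * (a ⋆ b) n
  ⋆-scaleʳ x a b n =
    trans (⋆-comm a _ n) (trans (⋆-scaleˡ x b a n) (*-congˡ (⋆-comm b a n)))

  ⋆-assoc : ∀ a b d n → ((a ⋆ b) ⋆ d) n ≈ (a ⋆ (b ⋆ d)) n
  ⋆-assoc a b d n = begin
    ∑ n (λ m → ∑ m (λ i → a i * b (m ∸ i)) * d (n ∸ m))
      ≈⟨ ∑-cong n (λ m _ → ∑-distribʳ m _ _) ⟩
    ∑ n (λ m → ∑ m (λ i → a i * b (m ∸ i) * d (n ∸ m)))
      ≈⟨ ∑-triangle n (λ i m → a i * b (m ∸ i) * d (n ∸ m)) ⟩
    ∑ n (λ i → ∑ (n ∸ i) (λ j → a i * b (i ℕ.+ j ∸ i) * d (n ∸ (i ℕ.+ j))))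
      ≈⟨ ∑-cong n (λ i _ → trans (∑-cong (n ∸ i) (λ j _ → reindex i j))
                                 (sym (∑-distribˡ (n ∸ i) (a i) _))) ⟩
    ∑ n (λ i → a i * ∑ (n ∸ i) (λ j → b j * d (n ∸ i ∸ j))) ∎
    where
    reindex : ∀ i j → a i * b (i ℕ.+ j ∸ i) * d (n ∸ (i ℕ.+ j)) ≈ a i * (b j * d (n ∸ i ∸ j))
    reindex i j = trans (*-assoc _ _ _) (*-congˡ (*-cong
      (reflexive (≡.cong b (ℕₚ.m+n∸m≡n i j))) (reflexive (≡.cong d (≡.sym (ℕₚ.∸-+-assoc n i j))))))

  ⋆-identityˡ : ∀ b n → (δ ⋆ b) n ≈ b n
  ⋆-identityˡ b zero    = *-identityˡ _
  ⋆-identityˡ b (suc n) = begin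
    (δ ⋆ b) (suc n)                              ≈⟨ ∑-unfoldˡ n _ ⟩
    1# * b (suc n) + ∑ n (λ k → 0# * b (n ∸ k)) ≈⟨ +-cong (*-identityˡ _) (∑-zero n (λ k _ → zeroˡ _)) ⟩
    b (suc n) + 0#                               ≈⟨ +-identityʳ _ ⟩
    b (suc n)                                    ∎

  ⋆-solve : ∀ u v b w → (∀ n → (u ⋆ v) n ≈ δ n) → (∀ n → (u ⋆ b) n ≈ w n) →
            ∀ n → b n ≈ (v ⋆ w) n
  ⋆-solve u v b w u⋆v≈δ u⋆b≈w n = sym (begin
    (v ⋆ w) n       ≈⟨ ⋆-congʳ v u⋆b≈w n ⟨
    (v ⋆ (u ⋆ b)) n ≈⟨ ⋆-assoc v u b n ⟨
    ((v ⋆ u) ⋆ b) n ≈⟨ ⋆-congˡ b (λ m → trans (⋆-comm v u m) (u⋆v≈δ m)) n ⟩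
    (δ ⋆ b) n       ≈⟨ ⋆-identityˡ b n ⟩
    b n             ∎)

module GeometricSeries {c ℓ : Level} (R : CommutativeRing c ℓ) where
  open CommutativeRing R
  open Sums R
  open Powers R
  open Convolution R
  open import Relation.Binary.Reasoning.Setoid setoid
  open import Algebra.Solver.CommutativeMonoid *-commutativeMonoid using (solve; _⊜_; _⊕_)

  -- The coefficient of t^k in (Σ_{i ≥ 1} a i t^i)^r; the value a 0 is never used.
  compositionSum : (ℕ → Carrier) → ℕ → ℕ → Carrier
  compositionSum a zero    zero    = 1#
  compositionSum a zero    (suc k) = 0#
  compositionSum a (suc r) k       = ∑₁ k (λ i → a i * compositionSum a r (k ∸ i))

  compositionSum-cong : ∀ {a b} → (∀ i → a i ≈ b i) → ∀ r k →
                        compositionSum a r k ≈ compositionSum b r k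
  compositionSum-cong a≈b zero    zero    = refl
  compositionSum-cong a≈b zero    (suc k) = refl
  compositionSum-cong a≈b (suc r) k       =
    ∑₁-cong k (λ i _ _ → *-cong (a≈b i) (compositionSum-cong a≈b r (k ∸ i)))

  compositionSum-< : ∀ a r k → k < r → compositionSum a r k ≈ 0#
  compositionSum-< a (suc r) k k<1+r = ∑₁-zero k (λ i 1≤i i≤k →
    trans (*-congˡ (compositionSum-< a r (k ∸ i)
                      (ℕₚ.<-≤-trans (ℕₚ.∸-monoʳ-< {k} {i} {0} 1≤i i≤k) (ℕₚ.≤-pred k<1+r))))
          (zeroʳ _))

  compositionSum-scale : ∀ x y a r k →
    compositionSum (λ i → x * (pow R y i * a i)) r k ≈ pow R x r * (pow R y k * compositionSum a r k)
  compositionSum-scale x y a zero zero    = sym (trans (*-identityˡ _) (*-identityˡ _))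
  compositionSum-scale x y a zero (suc k) = sym (trans (*-identityˡ _) (zeroʳ _))
  compositionSum-scale x y a (suc r) k    = begin
    ∑₁ k (λ i → x * (pow R y i * a i) * compositionSum a′ r (k ∸ i))
      ≈⟨ ∑₁-cong k (λ i _ i≤k → term i i≤k) ⟩
    ∑₁ k (λ i → (x * pow R x r) * (pow R y k * (a i * compositionSum a r (k ∸ i))))
      ≈⟨ ∑₁-distribˡ k (x * pow R x r) _ ⟨
    (x * pow R x r) * ∑₁ k (λ i → pow R y k * (a i * compositionSum a r (k ∸ i)))
      ≈⟨ *-congˡ (∑₁-distribˡ k (pow R y k) _) ⟨
    (x * pow R x r) * (pow R y k * ∑₁ k (λ i → a i * compositionSum a r (k ∸ i))) ∎
    where
    a′ : ℕ → Carrier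
    a′ i = x * (pow R y i * a i)
    term : ∀ i → i ≤ k → x * (pow R y i * a i) * compositionSum a′ r (k ∸ i)
                         ≈ (x * pow R x r) * (pow R y k * (a i * compositionSum a r (k ∸ i)))
    term i i≤k = begin
      x * (pow R y i * a i) * compositionSum a′ r (k ∸ i)
        ≈⟨ *-congˡ (compositionSum-scale x y a r (k ∸ i)) ⟩
      x * (pow R y i * a i) * (pow R x r * (pow R y (k ∸ i) * compositionSum a r (k ∸ i)))
        ≈⟨ solve 6 (λ x yi ai xr yki s → (x ⊕ (yi ⊕ ai)) ⊕ (xr ⊕ (yki ⊕ s))
                                        ⊜ (x ⊕ xr) ⊕ ((yi ⊕ yki) ⊕ (ai ⊕ s))) refl
                   x (pow R y i) (a i) (pow R x r) (pow R y (k ∸ i)) (compositionSum a r (k ∸ i)) ⟩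
      (x * pow R x r) * ((pow R y i * pow R y (k ∸ i)) * (a i * compositionSum a r (k ∸ i)))
        ≈⟨ *-congˡ (*-congʳ (pow-split y i≤k)) ⟨
      (x * pow R x r) * (pow R y k * (a i * compositionSum a r (k ∸ i))) ∎

  -- The coefficient of t^k in Σ_r (-A(t))^r, where A(t) = Σ_{i ≥ 1} a i t^i.
  geometricInverse : (ℕ → Carrier) → ℕ → Carrier
  geometricInverse a k = ∑ k (λ r → compositionSum (λ i → - a i) r k)

  geometricInverse-suc : ∀ a k →
    geometricInverse a (suc k) ≈ - ∑₁ (suc k) (λ i → a i * geometricInverse a (suc k ∸ i))
  geometricInverse-suc a k = begin
    geometricInverse a (suc k)
      ≈⟨ ∑-unfoldˡ k _ ⟩
    0# + ∑ k (λ r → ∑₁ (suc k) (λ i → - a i * compositionSum -a r (suc k ∸ i)))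
      ≈⟨ +-identityˡ _ ⟩
    ∑ k (λ r → ∑₁ (suc k) (λ i → - a i * compositionSum -a r (suc k ∸ i)))
      ≈⟨ ∑-∑₁-comm k (suc k) _ ⟩
    ∑₁ (suc k) (λ i → ∑ k (λ r → - a i * compositionSum -a r (suc k ∸ i)))
      ≈⟨ ∑₁-cong (suc k) (λ i 1≤i _ → term i 1≤i) ⟩
    ∑₁ (suc k) (λ i → - (a i * geometricInverse a (suc k ∸ i)))
      ≈⟨ ∑₁-neg (suc k) _ ⟩
    - ∑₁ (suc k) (λ i → a i * geometricInverse a (suc k ∸ i)) ∎
    where
    -a : ℕ → Carrier
    -a i = - a i
    open import Algebra.Properties.Ring ring using (-‿distribˡ-*)
    -- Terms with r > suc k ∸ i vanish, so the inner sum is a full geometricInverse coefficient.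
    term : ∀ i → 1 ≤ i → ∑ k (λ r → - a i * compositionSum -a r (suc k ∸ i))
                         ≈ - (a i * geometricInverse a (suc k ∸ i))
    term i 1≤i = begin
      ∑ k (λ r → - a i * compositionSum -a r (suc k ∸ i))
        ≈⟨ ∑-distribˡ k (- a i) _ ⟨
      - a i * ∑ k (λ r → compositionSum -a r (suc k ∸ i))
        ≈⟨ *-congˡ (∑-truncate (suc k ∸ i) k _ (ℕₚ.∸-monoʳ-≤ (suc k) 1≤i)
                      (λ r k-i<r _ → compositionSum-< -a r (suc k ∸ i) k-i<r)) ⟩
      - a i * geometricInverse a (suc k ∸ i)
        ≈⟨ -‿distribˡ-* _ _ ⟨
      - (a i * geometricInverse a (suc k ∸ i)) ∎

  ⋆-geometricInverse : ∀ a → a 0 ≈ 1# → ∀ n → (a ⋆ geometricInverse a) n ≈ δ n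
  ⋆-geometricInverse a a0≈1 zero = trans (*-identityʳ _) a0≈1
  ⋆-geometricInverse a a0≈1 (suc k) = begin
    (a ⋆ geometricInverse a) (suc k)        ≈⟨ ∑-split₁ (suc k) _ ⟩
    a 0 * geometricInverse a (suc k) + rest ≈⟨ +-congʳ (trans (*-congʳ a0≈1) (*-identityˡ _)) ⟩
    geometricInverse a (suc k) + rest       ≈⟨ +-congʳ (geometricInverse-suc a k) ⟩
    - rest + rest                           ≈⟨ -‿inverseˡ rest ⟩
    0#                                      ∎
    where
    rest : Carrier
    rest = ∑₁ (suc k) (λ i → a i * geometricInverse a (suc k ∸ i))

module CharZeroField {c ℓ : Level} (K : CommutativeRing c ℓ)
  (inv : CommutativeRing.Carrier K → CommutativeRing.Carrier K)
  (isField : IsCharZeroField K inv) where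
  open CommutativeRing K
  open IsCharZeroField isField
  open Powers K
  open import Relation.Binary.Reasoning.Setoid setoid

  ι-nonzero : ∀ n → .{{NonZero n}} → ¬ ι K n ≈ 0#
  ι-nonzero (suc n) = charZero n

  ι-fact-nonzero : ∀ n → ¬ ι K (fact n) ≈ 0#
  ι-fact-nonzero n = ι-nonzero (fact n) {{fact-nonZero n}}

  *-nonzero : ∀ {x y} → ¬ x ≈ 0# → ¬ y ≈ 0# → ¬ x * y ≈ 0#
  *-nonzero {x} {y} x≉0 y≉0 xy≈0 = x≉0 (begin
    x                ≈⟨ *-identityʳ x ⟨
    x * 1#           ≈⟨ *-congˡ (inverseʳ y y≉0) ⟨
    x * (y * inv y)  ≈⟨ *-assoc _ _ _ ⟨
    (x * y) * inv y  ≈⟨ *-congʳ xy≈0 ⟩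
    0# * inv y       ≈⟨ zeroˡ _ ⟩
    0#               ∎)

  pow-nonzero : ∀ {x} → ¬ x ≈ 0# → ∀ k → ¬ pow K x k ≈ 0#
  pow-nonzero x≉0 zero    = 1≉0
  pow-nonzero x≉0 (suc k) = *-nonzero x≉0 (pow-nonzero x≉0 k)

  fact*invFact[n∸k] : ∀ {n k} → k ≤ n →
    ι K (fact n) * inv (ι K (fact (n ∸ k))) ≈ ι K (fact k) * ι K (n C k)
  fact*invFact[n∸k] {n} {k} k≤n = begin
    ι K (fact n) * inv (ι K (fact (n ∸ k)))
      ≈⟨ *-congʳ (reflexive (≡.cong (ι K) (fact*C*fact≡fact k≤n))) ⟨
    ι K (fact k ℕ.* (n C k) ℕ.* fact (n ∸ k)) * inv (ι K (fact (n ∸ k)))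
      ≈⟨ *-congʳ (trans (ι-homo-* (fact k ℕ.* (n C k)) (fact (n ∸ k))) (*-congʳ (ι-homo-* (fact k) (n C k)))) ⟩
    ι K (fact k) * ι K (n C k) * ι K (fact (n ∸ k)) * inv (ι K (fact (n ∸ k)))
      ≈⟨ *-assoc _ _ _ ⟩
    ι K (fact k) * ι K (n C k) * (ι K (fact (n ∸ k)) * inv (ι K (fact (n ∸ k))))
      ≈⟨ *-congˡ (inverseʳ _ (ι-fact-nonzero (n ∸ k))) ⟩
    ι K (fact k) * ι K (n C k) * 1#
      ≈⟨ *-identityʳ _ ⟩
    ι K (fact k) * ι K (n C k) ∎

module HypergeometricBernoulli {c ℓ : Level} (K : CommutativeRing c ℓ)
  (inv : CommutativeRing.Carrier K → CommutativeRing.Carrier K)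
  (isField : IsCharZeroField K inv) (N f : ℕ) (χ : ℤ → CommutativeRing.Carrier K)
  (1≤f : 1 ≤ f) where
  open CommutativeRing K
  open IsCharZeroField isField
  open Sums K
  open Powers K
  open Convolution K
  open GeometricSeries K
  open CharZeroField K inv isField
  open import Relation.Binary.Reasoning.Setoid setoid
  open import Algebra.Solver.CommutativeMonoid *-commutativeMonoid using (solve; _⊜_; _⊕_)

  N! : Carrier
  N! = ι K (fact N)

  f^ : ℕ → Carrier
  f^ = pow K (ι K f)

  invFact : ℕ → Carrier
  invFact m = inv (ι K (fact m))

  N!*invFact[N] : N! * invFact N ≈ 1#
  N!*invFact[N] = inverseʳ N! (ι-fact-nonzero N)

  -- The coefficients of (e^{ft} - Σ_{m<N} (ft)^m/m!) · N!/(ft)^N, with constant term 1.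
  g : ℕ → Carrier
  g i = N! * (f^ i * invFact (N ℕ.+ i))

  g-zero : g 0 ≈ 1#
  g-zero rewrite ℕₚ.+-identityʳ N = trans (*-congˡ (*-identityˡ _)) N!*invFact[N]

  N!*D≈f^N*g : ∀ j → N! * D K inv N f χ j ≈ f^ N * g j
  N!*D≈f^N*g j = begin
    N! * (f^ (N ℕ.+ j) * invFact (N ℕ.+ j))         ≈⟨ *-congˡ (*-congʳ (pow-homo-* (ι K f) N j)) ⟩
    N! * (f^ N * f^ j * invFact (N ℕ.+ j))          ≈⟨ solve 4 (λ n a b c → n ⊕ ((a ⊕ b) ⊕ c) ⊜ a ⊕ (n ⊕ (b ⊕ c))) refl
                                                          N! (f^ N) (f^ j) (invFact (N ℕ.+ j)) ⟩
    f^ N * g j                                      ∎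

  compSum≈compositionSum : ∀ r k →
    compSum K inv N f χ r k ≈ compositionSum (λ i → invFact (N ℕ.+ i)) r k
  compSum≈compositionSum zero    zero    = refl
  compSum≈compositionSum zero    (suc k) = refl
  compSum≈compositionSum (suc r) k       =
    ∑₁-cong k (λ i _ _ → *-congˡ (compSum≈compositionSum r (k ∸ i)))

  f^*T≈compositionSum : ∀ r k → f^ k * T K inv N f χ r k ≈ compositionSum (λ i → - g i) r k
  f^*T≈compositionSum r k = begin
    f^ k * (pow K (- N!) r * compSum K inv N f χ r k)
      ≈⟨ x∙yz≈y∙xz _ _ _ ⟩
    pow K (- N!) r * (f^ k * compSum K inv N f χ r k)
      ≈⟨ *-congˡ (*-congˡ (compSum≈compositionSum r k)) ⟩
    pow K (- N!) r * (f^ k * compositionSum (λ i → invFact (N ℕ.+ i)) r k)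
      ≈⟨ compositionSum-scale (- N!) (ι K f) _ r k ⟨
    compositionSum (λ i → - N! * (f^ i * invFact (N ℕ.+ i))) r k
      ≈⟨ compositionSum-cong (λ i → sym (-‿distribˡ-* N! _)) r k ⟩
    compositionSum (λ i → - g i) r k ∎
    where
    open import Algebra.Properties.Ring ring using (-‿distribˡ-*)
    open import Algebra.Properties.CommutativeSemigroup *-commutativeSemigroup using (x∙yz≈y∙xz)

  f^N*invFPow : ∀ k → f^ N * invFPow K inv N f χ k ≈ f^ k
  f^N*invFPow k with k ≤? N
  ... | yes k≤N = begin
    f^ N * inv (f^ (N ∸ k))                 ≈⟨ *-congʳ (pow-split (ι K f) k≤N) ⟩
    f^ k * f^ (N ∸ k) * inv (f^ (N ∸ k))    ≈⟨ *-assoc _ _ _ ⟩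
    f^ k * (f^ (N ∸ k) * inv (f^ (N ∸ k)))  ≈⟨ *-congˡ (inverseʳ _ (pow-nonzero ιf≉0 (N ∸ k))) ⟩
    f^ k * 1#                               ≈⟨ *-identityʳ _ ⟩
    f^ k                                    ∎
    where
    ιf≉0 : ¬ ι K f ≈ 0#
    ιf≉0 = ι-nonzero f {{ℕ.>-nonZero 1≤f}}
  ... | no k≰N = sym (pow-split (ι K f) (ℕₚ.≰⇒≥ k≰N))

  -- The sequence k ↦ Σ_r T_r(k)/f^{N-k} that the formula convolves with S.
  e : ℕ → Carrier
  e k = invFPow K inv N f χ k * ∑ k (λ r → T K inv N f χ r k)

  f^N*e≈geometricInverse : ∀ k → f^ N * e k ≈ geometricInverse g k
  f^N*e≈geometricInverse k = begin
    f^ N * (invFPow K inv N f χ k * ∑ k (λ r → T K inv N f χ r k))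
      ≈⟨ *-assoc _ _ _ ⟨
    f^ N * invFPow K inv N f χ k * ∑ k (λ r → T K inv N f χ r k)
      ≈⟨ *-congʳ (f^N*invFPow k) ⟩
    f^ k * ∑ k (λ r → T K inv N f χ r k)
      ≈⟨ ∑-distribˡ k (f^ k) _ ⟩
    ∑ k (λ r → f^ k * T K inv N f χ r k)
      ≈⟨ ∑-cong k (λ r _ → f^*T≈compositionSum r k) ⟩
    geometricInverse g k ∎

  N!*D⋆e≈δ : ∀ n → ((λ j → N! * D K inv N f χ j) ⋆ e) n ≈ δ n
  N!*D⋆e≈δ n = begin
    ((λ j → N! * D K inv N f χ j) ⋆ e) n ≈⟨ ⋆-congˡ e N!*D≈f^N*g n ⟩
    ((λ j → f^ N * g j) ⋆ e) n           ≈⟨ ⋆-scaleˡ (f^ N) g e n ⟩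
    f^ N * (g ⋆ e) n                     ≈⟨ ⋆-scaleʳ (f^ N) g e n ⟨
    (g ⋆ (λ k → f^ N * e k)) n           ≈⟨ ⋆-congʳ g f^N*e≈geometricInverse n ⟩
    (g ⋆ geometricInverse g) n           ≈⟨ ⋆-geometricInverse g g-zero n ⟩
    δ n                                  ∎

  B≈formula : ∀ (s B : ℕ → Carrier) →
    (∀ n → (D K inv N f χ ⋆ (λ m → B m * invFact m)) n ≈ s n * invFact N * invFact n) →
    ∀ n → B n ≈ formula K inv N f χ s n
  B≈formula s B D⋆b≈s n = begin
    B n                                      ≈⟨ *-identityʳ _ ⟨
    B n * 1#                                 ≈⟨ *-congˡ (trans (*-comm _ _) (inverseʳ _ (ι-fact-nonzero n))) ⟨
    B n * (invFact n * ι K (fact n))         ≈⟨ trans (sym (*-assoc _ _ _)) (*-comm _ _) ⟩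
    ι K (fact n) * b n                       ≈⟨ *-congˡ (⋆-solve _ e b s′ N!*D⋆e≈δ N!*D⋆b≈s′ n) ⟩
    ι K (fact n) * (e ⋆ s′) n                ≈⟨ ∑-distribˡ n _ _ ⟩
    ∑ n (λ k → ι K (fact n) * (e k * s′ (n ∸ k))) ≈⟨ ∑-cong n term ⟩
    formula K inv N f χ s n                  ∎
    where
    b s′ : ℕ → Carrier
    b m = B m * invFact m
    s′ m = s m * invFact m
    N!*D⋆b≈s′ : ∀ m → ((λ j → N! * D K inv N f χ j) ⋆ b) m ≈ s′ m
    N!*D⋆b≈s′ m = begin
      ((λ j → N! * D K inv N f χ j) ⋆ b) m ≈⟨ ⋆-scaleˡ N! _ b m ⟩
      N! * (D K inv N f χ ⋆ b) m           ≈⟨ *-congˡ (D⋆b≈s m) ⟩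
      N! * (s m * invFact N * invFact m)   ≈⟨ solve 4 (λ n x i j → n ⊕ ((x ⊕ i) ⊕ j) ⊜ (n ⊕ i) ⊕ (x ⊕ j)) refl
                                                  N! (s m) (invFact N) (invFact m) ⟩
      N! * invFact N * s′ m                ≈⟨ *-congʳ N!*invFact[N] ⟩
      1# * s′ m                            ≈⟨ *-identityˡ _ ⟩
      s′ m                                 ∎
    term : ∀ k → k ≤ n → ι K (fact n) * (e k * s′ (n ∸ k))
      ≈ ι K (fact k) * invFPow K inv N f χ k * ι K (n C k) * (∑ k (λ r → T K inv N f χ r k) * s (n ∸ k))
    term k k≤n = begin
      ι K (fact n) * ((P * Σ) * (σ * invFact (n ∸ k)))
        ≈⟨ solve 5 (λ n! p t σ i → n! ⊕ ((p ⊕ t) ⊕ (σ ⊕ i)) ⊜ (n! ⊕ i) ⊕ (p ⊕ (t ⊕ σ))) refl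
                   (ι K (fact n)) P Σ σ (invFact (n ∸ k)) ⟩
      (ι K (fact n) * invFact (n ∸ k)) * (P * (Σ * σ))
        ≈⟨ *-congʳ (fact*invFact[n∸k] k≤n) ⟩
      (ι K (fact k) * ι K (n C k)) * (P * (Σ * σ))
        ≈⟨ solve 5 (λ a c p t σ → (a ⊕ c) ⊕ (p ⊕ (t ⊕ σ)) ⊜ ((a ⊕ p) ⊕ c) ⊕ (t ⊕ σ)) refl
                   (ι K (fact k)) (ι K (n C k)) P Σ σ ⟩
      ι K (fact k) * P * ι K (n C k) * (Σ * σ) ∎
      where
      P Σ σ : Carrier
      P = invFPow K inv N f χ k
      Σ = ∑ k (λ r → T K inv N f χ r k)
      σ = s (n ∸ k)

theorem5p1 : ∀ {c ℓ : Level} (K : CommutativeRing c ℓ)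
    (inv : CommutativeRing.Carrier K → CommutativeRing.Carrier K) →
    IsCharZeroField K inv →
    (N : ℕ) → 1 ≤ N →
    (f : ℕ) (χ : ℤ → CommutativeRing.Carrier K) →
    IsDirichletCharacterOfConductor K f χ →
    (∀ (B : ℕ → CommutativeRing.Carrier K) →
      IsHypBernoulliNumbers K inv N f χ B →
      ∀ n → 1 ≤ n →
      CommutativeRing._≈_ K (B n) (formula K inv N f χ (S K inv N f χ) n))
    ×
    (∀ (x : CommutativeRing.Carrier K) (B : ℕ → CommutativeRing.Carrier K) →
      IsHypBernoulliPolys K inv N f χ x B →
      ∀ n → 1 ≤ n →
      CommutativeRing._≈_ K (B n) (formula K inv N f χ (Sx K inv N f χ x) n))
theorem5p1 K inv isField N _ f χ conductor =
  (λ B isB n _ → B≈formula (S K inv N f χ) B isB n) ,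
  (λ x B isB n _ → B≈formula (Sx K inv N f χ x) B isB n)
  where
  open HypergeometricBernoulli K inv isField N f χ
    (IsDirichletCharacter.modulus-pos (IsDirichletCharacterOfConductor.isDirichletCharacter conductor))
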